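{- The structure $(\mathbb{A}/_{\simeq_{\mathbb{A}}},\bullet,[\#\mathsf{K}],[\#\mathsf{S}])$, where $[a]\bullet[b]=[a\cdot b]$ and $[c]$ is the $\simeq_{\mathbb{A}}$-class of $c$, is a combinatory algebra which is not extensional.
   Context: Addressing machines. Fix a countable set $\mathbb{A}$ of addresses and a symbol $\varnothing\notin\mathbb{A}$; put $\mathbb{A}_\varnothing=\mathbb{A}\cup\{\varnothing\}$. A tape is a finite list $[a_1,\dots,a_n]$ of elements of $\mathbb{A}$; $a::T$ is the tape with head $a$ and tail $T$, and $T@T'$ is concatenation. A program is a finite list of instructions generated by the grammar $P::=\mathtt{Load}\ i;P\mid A$, $A::=\mathtt{App}(i,j,k);A\mid C$, $C::=\mathtt{Call}\ i\mid\varepsilon$ with $i,j,k\in\mathbb{N}$ ($\varepsilon$ is the empty program). For $r\in\mathbb{N}$ and $I\subseteq\{0,\dots,r-1\}$, $I\models^r P$ is the least relation such that: $I\models^r\varepsilon$; $I\models^r\mathtt{Call}\ i$ if $i\in I$; $I\models^r\mathtt{App}(i,j,k);A$ if $i,j\in I$ and either ($k<r$ and $I\cup\{k\}\models^r A$) or ($k\ge r$ and $I\models^r A$); $I\models^r\mathtt{Load}\ i;P$ if either ($i<r$ and $I\cup\{i\}\models^r P$) or ($i\ge r$ and $I\models^r P$). An addressing machine is $M=\langle R_0,\dots,R_{r-1},P,T\rangle$ with registers $R_i\in\mathbb{A}_\varnothing$, a program $P$ valid w.r.t. the registers (i.e. $\{i<r\mid R_i\ne\varnothing\}\models^r P$)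 and a tape $T$; $\mathcal{M}$ is the set of all addressing machines, and $M.r,M.\vec R,M.R_i,M.P,M.T$ denote the components. $\vec R[R_i:=a]$ is $\vec R$ with $R_i$ replaced by $a$ if $i<r$, and unchanged if $i\ge r$. Fix a bijection $\#:\mathcal{M}\to\mathbb{A}$ with inverse $\#^{ -1}$. For a tape $T'$, $M@T'=\langle M.\vec R,M.P,M.T@T'\rangle$; application of addresses is $a\cdot b=\#(\#^{ -1}(a)@[b])$ (left-associative). Head reduction $\to_h$ is the least relation with $\langle\vec R,\mathtt{Load}\ i;P,a::T\rangle\to_h\langle\vec R[R_i:=a],P,T\rangle$, $\langle\vec R,\mathtt{App}(i,j,k);P,T\rangle\to_h\langle\vec R[R_k:=R_i\cdot R_j],P,T\rangle$, $\langle\vec R,\mathtt{Call}\ i,T\rangle\to_h\#^{ -1}(R_i)@T$; $\twoheadrightarrow_h$ is its reflexive-transitive closure. Induced relations. For a relation $\equiv_R$ on $\mathcal{M}$: $a\simeq_R b$ iff $\#^{ -1}(a)\equiv_R\#^{ -1}(b)$; on $\mathbb{A}_\varnothing$, $R\simeq_R R'$ iff both are $\varnothing$ or both are addresses related by $\simeq_R$; on tuples and tapes componentwise with equal lengths; $M=_R N$ iff $M.\vec R\simeq_R N.\vec R$, $M.P=N.P$ and $M.T\simeq_R N.T$. Evaluation equivalence $\equiv_{\mathbb{A}}$ is the least equivalence relation on $\mathcal{M}$ such that $M\twoheadrightarrow_h Z$ and $Z=_{\mathbb{A}}N$ imply $M\equiv_{\mathbb{A}}N$, with $\simeq_{\mathbb{A}},=_{\mathbb{A}}$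 induced by $\equiv_{\mathbb{A}}$. Machines: $\mathsf{K}=\langle\varnothing,\mathtt{Load}\ 0;\mathtt{Load}\ 1;\mathtt{Call}\ 0,[]\rangle$ (one register) and $\mathsf{S}=\langle\varnothing,\varnothing,\varnothing,\mathtt{Load}\ 0;\mathtt{Load}\ 1;\mathtt{Load}\ 2;\mathtt{App}(0,2,0);\mathtt{App}(1,2,1);\mathtt{App}(0,1,2);\mathtt{Call}\ 2,[]\rangle$ (three registers). A combinatory algebra is a set $C$ with a binary operation (application, left-associative) and constants $k\ne s$ such that $kxy=x$ and $sxyz=xz(yz)$ for all $x,y,z$; it is extensional if $\forall x\forall y(\forall z\,(xz=yz)\Rightarrow x=y)$. -}

module Defs where

open import Data.Nat using (ℕ; zero; suc)
open import Data.Bool using (Bool; true; false; _∧_; T)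
open import Data.Maybe using (Maybe; just; nothing; is-just)
open import Data.List using (List; []; _∷_; _++_; [_])
open import Data.Vec using (Vec; []; _∷_; map)
open import Data.Product using (_×_)
open import Relation.Nullary using (¬_)
open import Relation.Binary.PropositionalEquality using (_≡_)
open import Relation.Binary.Structures using (IsEquivalence)
open import Relation.Binary.Construct.Closure.ReflexiveTransitive using (Star)
open import Function.Bundles using (_↔_; Inverse)
import Data.Vec.Relation.Binary.Pointwise.Inductive as VecPW
import Data.List.Relation.Binary.Pointwise as ListPW
import Data.Maybe.Relation.Binary.Pointwise as MaybePW

data AProg : Set where
  App  : ℕ → ℕ → ℕ → AProg → AProg
  Call : ℕ → AProg
  ε    : AProg

data Prog : Set where
  Load : ℕ → Prog → Prog
  ⌜_⌝  : AProg → Prog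

-- Subsets I ⊆ {0,…,r-1} as characteristic vectors, indexed by naturals.

-- i ∈ I  (false when i ≥ r)
_∈ᵇ_ : ∀ {r} → ℕ → Vec Bool r → Bool
_∈ᵇ_ i       []      = false
_∈ᵇ_ zero    (b ∷ _) = b
_∈ᵇ_ (suc i) (_ ∷ I) = i ∈ᵇ I

-- I ∪ {i} if i < r, and I unchanged if i ≥ r
insert : ∀ {r} → ℕ → Vec Bool r → Vec Bool r
insert i       []      = []
insert zero    (_ ∷ I) = true ∷ I
insert (suc i) (b ∷ I) = b ∷ insert i I

-- I ⊨^r P  (decidable, Boolean-valued version of the least relation)
⊨A : ∀ {r} → Vec Bool r → AProg → Bool
⊨A I (App i j k A) = (i ∈ᵇ I) ∧ ((j ∈ᵇ I) ∧ ⊨A (insert k I) A)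
⊨A I (Call i)      = i ∈ᵇ I
⊨A I ε             = true

⊨P : ∀ {r} → Vec Bool r → Prog → Bool
⊨P I (Load i P) = ⊨P (insert i I) P
⊨P I ⌜ A ⌝      = ⊨A I A

-- Registers: R_i ∈ A ∪ {∅}, with ∅ represented by nothing.

-- R_i (nothing when i ≥ r; only used at valid indices)
lookupℕ : ∀ {A : Set} {r} → Vec (Maybe A) r → ℕ → Maybe A
lookupℕ []      _       = nothing
lookupℕ (x ∷ _) zero    = x
lookupℕ (_ ∷ R) (suc i) = lookupℕ R i

-- R⃗[R_i := a]  (unchanged if i ≥ r)
_[_≔_] : ∀ {A : Set} {r} → Vec (Maybe A) r → ℕ → A → Vec (Maybe A) r
[]      [ _     ≔ a ] = []
(_ ∷ R) [ zero  ≔ a ] = just a ∷ R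
(x ∷ R) [ suc i ≔ a ] = x ∷ (R [ i ≔ a ])

support : ∀ {A : Set} {r} → Vec (Maybe A) r → Vec Bool r
support = map is-just

record Machine (A : Set) : Set where
  constructor mach
  field
    {r}   : ℕ
    R     : Vec (Maybe A) r
    P     : Prog
    tape  : List A
    {valid} : T (⊨P (support R) P)

open Machine public

_++ₘ_ : ∀ {A : Set} → Machine A → List A → Machine A
M ++ₘ T' = record { R = R M ; P = P M ; tape = tape M ++ T' ; valid = valid M }

module Addressing {A : Set} (enc : Machine A ↔ A) where

  # : Machine A → A
  # = Inverse.to enc

  #⁻¹ : A → Machine A
  #⁻¹ = Inverse.from enc

  infixl 7 _·_
  _·_ : A → A → A
  a · b = # (#⁻¹ a ++ₘ [ b ])

  infix 4 _→h_ _↠h_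
  data _→h_ : Machine A → Machine A → Set where
    load : ∀ {r} {R : Vec (Maybe A) r} {i P a Tp v v′} →
           mach R (Load i P) (a ∷ Tp) {v} →h mach (R [ i ≔ a ]) P Tp {v′}
    app  : ∀ {r} {R : Vec (Maybe A) r} {i j k Ap Tp a b v v′} →
           lookupℕ R i ≡ just a → lookupℕ R j ≡ just b →
           mach R ⌜ App i j k Ap ⌝ Tp {v} →h mach (R [ k ≔ a · b ]) ⌜ Ap ⌝ Tp {v′}
    call : ∀ {r} {R : Vec (Maybe A) r} {i Tp a v} →
           lookupℕ R i ≡ just a →
           mach R ⌜ Call i ⌝ Tp {v} →h (#⁻¹ a ++ₘ Tp)

  _↠h_ : Machine A → Machine A → Set
  _↠h_ = Star _→h_

  infix 4 _≡𝔸_ _=𝔸_ _≃𝔸_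
  mutual
    data _≡𝔸_ : Machine A → Machine A → Set where
      eval  : ∀ {M Z N} → M ↠h Z → Z =𝔸 N → M ≡𝔸 N
      refl𝔸  : ∀ {M} → M ≡𝔸 M
      sym𝔸   : ∀ {M N} → M ≡𝔸 N → N ≡𝔸 M
      trans𝔸 : ∀ {M N L} → M ≡𝔸 N → N ≡𝔸 L → M ≡𝔸 L

    data _=𝔸_ : Machine A → Machine A → Set where
      mk : ∀ {M N} →
           VecPW.Pointwise (MaybePW.Pointwise (λ a b → #⁻¹ a ≡𝔸 #⁻¹ b)) (R M) (R N) →
           P M ≡ P N →
           ListPW.Pointwise (λ a b → #⁻¹ a ≡𝔸 #⁻¹ b) (tape M) (tape N) →
           M =𝔸 N

  _≃𝔸_ : A → A → Set
  a ≃𝔸 b = #⁻¹ a ≡𝔸 #⁻¹ b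

𝖪 : ∀ {A : Set} → Machine A
𝖪 = mach (nothing ∷ []) (Load 0 (Load 1 ⌜ Call 0 ⌝)) []

𝖲 : ∀ {A : Set} → Machine A
𝖲 = mach (nothing ∷ nothing ∷ nothing ∷ [])
         (Load 0 (Load 1 (Load 2 ⌜ App 0 2 0 (App 1 2 1 (App 0 1 2 (Call 2))) ⌝))) []

-- Combinatory algebras, presented on a carrier C modulo an equivalence _≈_
-- (i.e. the quotient C/≈ with the induced operation).

record IsCombinatoryAlgebra {C : Set} (_≈_ : C → C → Set) (_∙_ : C → C → C) (k s : C) : Set where
  field
    isEquivalence : IsEquivalence _≈_
    ∙-cong : ∀ {x x′ y y′} → x ≈ x′ → y ≈ y′ → (x ∙ y) ≈ (x′ ∙ y′)
    k≠s    : ¬ (k ≈ s)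
    k-law  : ∀ x y → ((k ∙ x) ∙ y) ≈ x
    s-law  : ∀ x y z → (((s ∙ x) ∙ y) ∙ z) ≈ ((x ∙ z) ∙ (y ∙ z))

Extensional : {C : Set} (_≈_ : C → C → Set) (_∙_ : C → C → C) → Set
Extensional {C} _≈_ _∙_ = ∀ x y → (∀ z → (x ∙ z) ≈ (y ∙ z)) → x ≈ y

-- The combinatory laws are head reductions of 𝖪 and 𝖲 applied to their arguments; the
-- content of the theorem is that ≃𝔸 does not collapse too much. Call a machine awaiting if
-- its program starts with Load and its tape is empty: it is stuck. Let M ⇛ N mean that M
-- head-reduces to a machine with N's program whose registers and tape cells are ⇛-related
-- to those of N. Changing one register or cell at a time shows that ≡𝔸 lies in the
-- equivalence closure of ⇛. Along a ⇛-step, "reduces to an awaiting machine with program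
-- Load i; q" is preserved in both directions: agreeing machines simulate each other step by
-- step (a Call turns ⇛-related registers into ⇛-related machines), and since head reduction
-- is deterministic the reduction of M to a stuck machine passes through any reduct of M.
-- Hence ≡𝔸-related awaiting machines have the same program, so 𝖪 ≄ 𝖲. Likewise λx.x and a
-- machine computing x·x, discarding it and returning x agree on every argument but are
-- not identified, so the algebra is not extensional.

module Submission where

open import Defs
open import Data.Nat using (ℕ; zero; suc)
open import Data.Bool using (T)
open import Data.Bool.Properties using (T-irrelevant)
open import Data.Maybe using (Maybe; just; nothing)
open import Data.List using ([]; _∷_; _++_; [_]; foldl)
open import Data.List.Properties using (++-assoc; ++-identityʳ)
open import Data.Vec using (Vec; []; _∷_)
open import Data.Product using (_×_; _,_; proj₁; ∃-syntax)
open import Data.Empty using (⊥-elim)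
open import Function using (flip; _↔_; _↣_; Inverse)
open import Relation.Nullary using (¬_)
open import Relation.Binary.Core using (_⇒_)
open import Relation.Binary.Definitions using (Reflexive)
open import Relation.Binary.PropositionalEquality using (_≡_; refl; sym; trans; cong; subst; subst₂; module ≡-Reasoning)
open import Relation.Binary.Construct.Closure.ReflexiveTransitive using (ε; _◅_; _◅◅_)
open import Relation.Binary.Construct.Closure.Symmetric using (fwd; bwd)
open import Relation.Binary.Construct.Closure.Equivalence as EqClosure using (EqClosure)
import Data.Vec.Relation.Binary.Pointwise.Inductive as VecPW
import Data.List.Relation.Binary.Pointwise as ListPW
import Data.Maybe.Relation.Binary.Pointwise as MaybePW
open VecPW using ([]; _∷_)
open ListPW using ([]; _∷_)
open MaybePW using (just; nothing)

module _ {B : Set} {S : B → B → Set} where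

  Pointwise-EqClosure-maybe : MaybePW.Pointwise (EqClosure S) ⇒ EqClosure (MaybePW.Pointwise S)
  Pointwise-EqClosure-maybe (just c) = EqClosure.gmap just just c
  Pointwise-EqClosure-maybe nothing  = ε

  Pointwise-EqClosure-vec : Reflexive S → ∀ {n} {xs ys : Vec B n} →
    VecPW.Pointwise (EqClosure S) xs ys → EqClosure (VecPW.Pointwise S) xs ys
  Pointwise-EqClosure-vec rfl []                  = ε
  Pointwise-EqClosure-vec rfl {xs = _ ∷ xs} {y ∷ _} (c ∷ p) =
    EqClosure.gmap (_∷ xs) (_∷ VecPW.refl rfl) c ◅◅
    EqClosure.gmap (y ∷_) (rfl ∷_) (Pointwise-EqClosure-vec rfl p)

  Pointwise-EqClosure-list : Reflexive S → ∀ {xs ys} →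
    ListPW.Pointwise (EqClosure S) xs ys → EqClosure (ListPW.Pointwise S) xs ys
  Pointwise-EqClosure-list rfl []                  = ε
  Pointwise-EqClosure-list rfl {_ ∷ xs} {y ∷ _} (c ∷ p) =
    EqClosure.gmap (_∷ xs) (_∷ ListPW.refl rfl) c ◅◅
    EqClosure.gmap (y ∷_) (rfl ∷_) (Pointwise-EqClosure-list rfl p)

Registers : {B : Set} → (B → B → Set) → ∀ {r} → Vec (Maybe B) r → Vec (Maybe B) r → Set
Registers ρ = VecPW.Pointwise (MaybePW.Pointwise ρ)

module _ {B : Set} {ρ : B → B → Set} where

  lookupℕ-Registers : ∀ {r} {R₁ R₂ : Vec (Maybe B) r} {a} → Registers ρ R₁ R₂ →
    ∀ i → lookupℕ R₁ i ≡ just a → ∃[ a′ ] lookupℕ R₂ i ≡ just a′ × ρ a a′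
  lookupℕ-Registers (just e ∷ _)  zero    refl = _ , refl , e
  lookupℕ-Registers (_      ∷ rs) (suc i) eq   = lookupℕ-Registers rs i eq

  ≔-Registers : ∀ {r} {R₁ R₂ : Vec (Maybe B) r} {a a′} → Registers ρ R₁ R₂ → ρ a a′ →
    ∀ i → Registers ρ (R₁ [ i ≔ a ]) (R₂ [ i ≔ a′ ])
  ≔-Registers []       e i       = []
  ≔-Registers (_ ∷ rs) e zero    = just e ∷ rs
  ≔-Registers (x ∷ rs) e (suc i) = x ∷ ≔-Registers rs e i

  support-Registers : ∀ {r} {R₁ R₂ : Vec (Maybe B) r} → Registers ρ R₁ R₂ → support R₁ ≡ support R₂
  support-Registers []             = refl
  support-Registers (just _ ∷ rs)  = cong (_ ∷_) (support-Registers rs)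
  support-Registers (nothing ∷ rs) = cong (_ ∷_) (support-Registers rs)

  ⊨-Registers : ∀ {r} {R₁ R₂ : Vec (Maybe B) r} {Q} → Registers ρ R₁ R₂ →
    T (⊨P (support R₁) Q) → T (⊨P (support R₂) Q)
  ⊨-Registers {Q = Q} rs = subst (λ I → T (⊨P I Q)) (support-Registers rs)

  ⊨-Registers⁻ : ∀ {r} {R₁ R₂ : Vec (Maybe B) r} {Q} → Registers ρ R₁ R₂ →
    T (⊨P (support R₂) Q) → T (⊨P (support R₁) Q)
  ⊨-Registers⁻ {Q = Q} rs = subst (λ I → T (⊨P I Q)) (sym (support-Registers rs))

module _ {B : Set} where

  ++ₘ-assoc : ∀ (M : Machine B) T₁ T₂ → (M ++ₘ T₁) ++ₘ T₂ ≡ M ++ₘ (T₁ ++ T₂)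
  ++ₘ-assoc M T₁ T₂ = cong (λ T′ → mach (R M) (P M) T′ {valid M}) (++-assoc (tape M) T₁ T₂)

  ++ₘ-identityʳ : ∀ (M : Machine B) → M ++ₘ [] ≡ M
  ++ₘ-identityʳ M = cong (λ T′ → mach (R M) (P M) T′ {valid M}) (++-identityʳ (tape M))

data Agree {B : Set} (ρ : B → B → Set) : Machine B → Machine B → Set where
  agree : ∀ {r} {R₁ R₂ : Vec (Maybe B) r} {Q T₁ T₂ v₁ v₂} →
          Registers ρ R₁ R₂ → ListPW.Pointwise ρ T₁ T₂ →
          Agree ρ (mach R₁ Q T₁ {v₁}) (mach R₂ Q T₂ {v₂})

module _ {B : Set} {ρ : B → B → Set} where

  Agree-refl : Reflexive ρ → Reflexive (Agree ρ)
  Agree-refl rfl = agree (VecPW.refl (MaybePW.refl rfl)) (ListPW.refl rfl)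

  Agree-sym : ∀ {M N} → Agree ρ M N → Agree (flip ρ) N M
  Agree-sym (agree rs ts) = agree (VecPW.sym (MaybePW.sym λ e → e) rs) (ListPW.symmetric (λ e → e) ts)

  Agree-++ₘ : ∀ {M N T₁ T₂} → Agree ρ M N → ListPW.Pointwise ρ T₁ T₂ → Agree ρ (M ++ₘ T₁) (N ++ₘ T₂)
  Agree-++ₘ (agree rs ts) ts′ = agree rs (ListPW.++⁺ ts ts′)

  EqClosure-Registers-Agree : ∀ {r} {R₁ R₂ : Vec (Maybe B) r} {Q Tp} →
    EqClosure (Registers ρ) R₁ R₂ → Reflexive ρ → (v₁ : T (⊨P (support R₁) Q)) (v₂ : T (⊨P (support R₂) Q)) →
    EqClosure (Agree ρ) (mach R₁ Q Tp {v₁}) (mach R₂ Q Tp {v₂})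
  EqClosure-Registers-Agree ε rfl v₁ v₂ with T-irrelevant v₁ v₂
  ... | refl = ε
  EqClosure-Registers-Agree {Q = Q} (fwd rs ◅ c) rfl v₁ v₂ =
    fwd (agree rs (ListPW.refl rfl)) ◅ EqClosure-Registers-Agree c rfl (⊨-Registers {Q = Q} rs v₁) v₂
  EqClosure-Registers-Agree {Q = Q} (bwd rs ◅ c) rfl v₁ v₂ =
    bwd (agree rs (ListPW.refl rfl)) ◅ EqClosure-Registers-Agree c rfl (⊨-Registers⁻ {Q = Q} rs v₁) v₂

  Agree-EqClosure : Reflexive ρ → ∀ {M N} → Agree (EqClosure ρ) M N → EqClosure (Agree ρ) M N
  Agree-EqClosure rfl (agree {R₂ = R₂} {Q} {v₁ = v₁} {v₂} rs ts) =
    EqClosure-Registers-Agree registers rfl v₁ v₂ ◅◅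
    EqClosure.gmap (λ T′ → mach R₂ Q T′ {v₂}) (agree (VecPW.refl (MaybePW.refl rfl))) cells
    where
    registers = Pointwise-EqClosure-vec (MaybePW.refl rfl) (VecPW.map Pointwise-EqClosure-maybe rs)
    cells = Pointwise-EqClosure-list rfl ts

module Properties {A : Set} (enc : Machine A ↔ A) where
  open Addressing enc

  #⁻¹∘# : ∀ M → #⁻¹ (# M) ≡ M
  #⁻¹∘# = Inverse.strictlyInverseʳ enc

  #∘#⁻¹ : ∀ a → # (#⁻¹ a) ≡ a
  #∘#⁻¹ = Inverse.strictlyInverseˡ enc

  #⁻¹-· : ∀ a b → #⁻¹ (a · b) ≡ #⁻¹ a ++ₘ [ b ]
  #⁻¹-· a b = #⁻¹∘# _

  #⁻¹-foldl-· : ∀ M xs → #⁻¹ (foldl _·_ (# M) xs) ≡ M ++ₘ xs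
  #⁻¹-foldl-· M []       = trans (#⁻¹∘# M) (sym (++ₘ-identityʳ M))
  #⁻¹-foldl-· M (x ∷ xs) = begin
    #⁻¹ (foldl _·_ (# (#⁻¹ (# M) ++ₘ [ x ])) xs) ≡⟨ #⁻¹-foldl-· (#⁻¹ (# M) ++ₘ [ x ]) xs ⟩
    (#⁻¹ (# M) ++ₘ [ x ]) ++ₘ xs                ≡⟨ cong (λ N → (N ++ₘ [ x ]) ++ₘ xs) (#⁻¹∘# M) ⟩
    (M ++ₘ [ x ]) ++ₘ xs                        ≡⟨ ++ₘ-assoc M [ x ] xs ⟩
    M ++ₘ (x ∷ xs)                              ∎
    where open ≡-Reasoning

  →h-++ₘ : ∀ {M N} Tp → M →h N → M ++ₘ Tp →h N ++ₘ Tp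
  →h-++ₘ Tp load      = load
  →h-++ₘ Tp (app p q) = app p q
  →h-++ₘ {M} Tp (call {Tp = Tp′} {a = a} p) =
    subst (M ++ₘ Tp →h_) (sym (++ₘ-assoc (#⁻¹ a) Tp′ Tp)) (call p)

  call-[] : ∀ {r} {R : Vec (Maybe A) r} {i a v} → lookupℕ R i ≡ just a → mach R ⌜ Call i ⌝ [] {v} →h #⁻¹ a
  call-[] {a = a} p = subst (_ →h_) (++ₘ-identityʳ (#⁻¹ a)) (call p)

  ↠h-++ₘ : ∀ {M N} Tp → M ↠h N → M ++ₘ Tp ↠h N ++ₘ Tp
  ↠h-++ₘ Tp ε       = ε
  ↠h-++ₘ Tp (s ◅ r) = →h-++ₘ Tp s ◅ ↠h-++ₘ Tp r

  →h-deterministic : ∀ {M N N′} → M →h N → M →h N′ → N ≡ N′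
  →h-deterministic (load {v′ = v}) (load {v′ = v′}) = cong (λ w → mach _ _ _ {w}) (T-irrelevant v v′)
  →h-deterministic (app {v′ = v} p q) (app {v′ = v′} p′ q′)
    with trans (sym p) p′ | trans (sym q) q′
  ... | refl | refl = cong (λ w → mach _ _ _ {w}) (T-irrelevant v v′)
  →h-deterministic (call p) (call p′) with trans (sym p) p′
  ... | refl = refl

  =𝔸-++ₘ : ∀ M {T₁ T₂} → ListPW.Pointwise _≃𝔸_ T₁ T₂ → M ++ₘ T₁ =𝔸 M ++ₘ T₂
  =𝔸-++ₘ M ts = mk (VecPW.refl (MaybePW.refl refl𝔸)) refl (ListPW.++⁺ (ListPW.refl refl𝔸) ts)

  ↠h⇒≡𝔸 : ∀ {M N} → M ↠h N → M ≡𝔸 N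
  ↠h⇒≡𝔸 r = eval r (mk (VecPW.refl (MaybePW.refl refl𝔸)) refl (ListPW.refl refl𝔸))

  ≡𝔸-++ₘ : ∀ {M N} Tp → M ≡𝔸 N → M ++ₘ Tp ≡𝔸 N ++ₘ Tp
  ≡𝔸-++ₘ Tp (eval r (mk rs ps ts)) = eval (↠h-++ₘ Tp r) (mk rs ps (ListPW.++⁺ ts (ListPW.refl refl𝔸)))
  ≡𝔸-++ₘ Tp refl𝔸        = refl𝔸
  ≡𝔸-++ₘ Tp (sym𝔸 d)     = sym𝔸 (≡𝔸-++ₘ Tp d)
  ≡𝔸-++ₘ Tp (trans𝔸 d e) = trans𝔸 (≡𝔸-++ₘ Tp d) (≡𝔸-++ₘ Tp e)

  ·-cong : ∀ {a a′ b b′} → a ≃𝔸 a′ → b ≃𝔸 b′ → a · b ≃𝔸 a′ · b′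
  ·-cong {a} {a′} {b} {b′} d e = subst₂ _≡𝔸_ (sym (#⁻¹-· a b)) (sym (#⁻¹-· a′ b′))
    (trans𝔸 (≡𝔸-++ₘ [ b ] d) (eval ε (=𝔸-++ₘ (#⁻¹ a′) (e ∷ []))))

  foldl-·-≃𝔸 : ∀ M xs {b} → M ++ₘ xs ↠h #⁻¹ b → foldl _·_ (# M) xs ≃𝔸 b
  foldl-·-≃𝔸 M xs {b} r = subst (_≡𝔸 #⁻¹ b) (sym (#⁻¹-foldl-· M xs)) (↠h⇒≡𝔸 r)

  k-law : ∀ x y → # 𝖪 · x · y ≃𝔸 x
  k-law x y = foldl-·-≃𝔸 𝖪 (x ∷ y ∷ []) (load ◅ load ◅ call-[] refl ◅ ε)

  s-law : ∀ x y z → # 𝖲 · x · y · z ≃𝔸 x · z · (y · z)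
  s-law x y z = foldl-·-≃𝔸 𝖲 (x ∷ y ∷ z ∷ [])
    (load ◅ load ◅ load ◅ app refl refl ◅ app refl refl ◅ app refl refl ◅
     call-[] refl ◅ ε)

  infix 4 _⇛_ _⇛ₐ_
  mutual
    data _⇛_ : Machine A → Machine A → Set where
      -- primitive: deriving it as ⇛-reduce ε with pointwise ⇛-refl would not terminate
      ⇛-refl   : ∀ {M} → M ⇛ M
      ⇛-reduce : ∀ {M Z N} → M ↠h Z → Agree _⇛ₐ_ Z N → M ⇛ N

    _⇛ₐ_ : A → A → Set
    a ⇛ₐ b = #⁻¹ a ⇛ #⁻¹ b

  ⇛-++ₘ : ∀ {M N T₁ T₂} → M ⇛ N → ListPW.Pointwise _⇛ₐ_ T₁ T₂ → M ++ₘ T₁ ⇛ N ++ₘ T₂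
  ⇛-++ₘ ⇛-refl          ts = ⇛-reduce ε (Agree-++ₘ (Agree-refl ⇛-refl) ts)
  ⇛-++ₘ (⇛-reduce r ag) ts = ⇛-reduce (↠h-++ₘ _ r) (Agree-++ₘ ag ts)

  ·-⇛ₐ : ∀ {a a′ b b′} → a ⇛ₐ a′ → b ⇛ₐ b′ → a · b ⇛ₐ a′ · b′
  ·-⇛ₐ {a} {a′} {b} {b′} d e = subst₂ _⇛_ (sym (#⁻¹-· a b)) (sym (#⁻¹-· a′ b′)) (⇛-++ₘ d (e ∷ []))

  module Simulation {ρ : A → A → Set} {σ : Machine A → Machine A → Set}
    (·-resp : ∀ {a a′ b b′} → ρ a a′ → ρ b b′ → ρ (a · b) (a′ · b′))
    (Agree⇒σ : ∀ {M N} → Agree ρ M N → σ M N)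
    (call-resp : ∀ {a a′ T₁ T₂} → ρ a a′ → ListPW.Pointwise ρ T₁ T₂ → σ (#⁻¹ a ++ₘ T₁) (#⁻¹ a′ ++ₘ T₂))
    where

    Agree-→h : ∀ {M N M′} → Agree ρ M N → M →h M′ → ∃[ N′ ] N →h N′ × σ M′ N′
    Agree-→h (agree rs (e ∷ ts)) (load {i = i} {P = Q} {v′ = v}) =
      _ , load {v′ = ⊨-Registers {Q = Q} rs′ v} , Agree⇒σ (agree rs′ ts)
      where rs′ = ≔-Registers rs e i
    Agree-→h (agree rs ts) (app {i = i} {j} {k} {Ap} {v′ = v} p q)
      with lookupℕ-Registers rs i p | lookupℕ-Registers rs j q
    ... | _ , p′ , d | _ , q′ , e =
      _ , app {v′ = ⊨-Registers {Q = ⌜ Ap ⌝} rs′ v} p′ q′ , Agree⇒σ (agree rs′ ts)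
      where rs′ = ≔-Registers rs (·-resp d e) k
    Agree-→h (agree rs ts) (call {i = i} p) with lookupℕ-Registers rs i p
    ... | _ , p′ , d = _ , call p′ , call-resp d ts

  Agree-⇛ₐ-→hˡ : ∀ {M N M′} → Agree _⇛ₐ_ M N → M →h M′ → ∃[ N′ ] N →h N′ × M′ ⇛ N′
  Agree-⇛ₐ-→hˡ = Simulation.Agree-→h ·-⇛ₐ (⇛-reduce ε) ⇛-++ₘ

  Agree-⇛ₐ-→hʳ : ∀ {M N N′} → Agree _⇛ₐ_ M N → N →h N′ → ∃[ M′ ] M →h M′ × M′ ⇛ N′
  Agree-⇛ₐ-→hʳ ag = Simulation.Agree-→h {σ = flip _⇛_} ·-⇛ₐ (λ ag′ → ⇛-reduce ε (Agree-sym ag′))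
    (λ d ts → ⇛-++ₘ d (ListPW.symmetric (λ e → e) ts)) (Agree-sym ag)

  Awaiting : ℕ → Prog → Machine A → Set
  Awaiting i q W = P W ≡ Load i q × tape W ≡ []

  EventuallyAwaiting : ℕ → Prog → Machine A → Set
  EventuallyAwaiting i q M = ∃[ W ] M ↠h W × Awaiting i q W

  module _ {i : ℕ} {q : Prog} where

    Awaiting-stuck : ∀ {W W′} → Awaiting i q W → ¬ (W →h W′)
    Awaiting-stuck (_  , ()) load
    Awaiting-stuck (() , _)  (app _ _)
    Awaiting-stuck (() , _)  (call _)

    Agree-Awaiting : ∀ {ρ : A → A → Set} {M N} → Agree ρ M N → Awaiting i q M → Awaiting i q N
    Agree-Awaiting (agree _ []) aw = aw

    ↠h-EventuallyAwaiting : ∀ {M N} → M ↠h N → EventuallyAwaiting i q N → EventuallyAwaiting i q M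
    ↠h-EventuallyAwaiting r (W , r′ , aw) = W , r ◅◅ r′ , aw

    ⇛-EventuallyAwaiting : ∀ {M N W} → M ⇛ N → M ↠h W → Awaiting i q W → EventuallyAwaiting i q N
    ⇛-EventuallyAwaiting ⇛-refl r aw = _ , r , aw
    ⇛-EventuallyAwaiting (⇛-reduce (s ◅ _) _) ε aw = ⊥-elim (Awaiting-stuck aw s)
    ⇛-EventuallyAwaiting (⇛-reduce (s ◅ r) ag) (s′ ◅ r′) aw with →h-deterministic s s′
    ... | refl = ⇛-EventuallyAwaiting (⇛-reduce r ag) r′ aw
    ⇛-EventuallyAwaiting (⇛-reduce ε ag) ε aw = _ , ε , Agree-Awaiting ag aw
    ⇛-EventuallyAwaiting (⇛-reduce ε ag) (s ◅ r) aw with Agree-⇛ₐ-→hˡ ag s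
    ... | _ , s′ , d = ↠h-EventuallyAwaiting (s′ ◅ ε) (⇛-EventuallyAwaiting d r aw)

    ⇛-EventuallyAwaiting⁻ : ∀ {M N W} → M ⇛ N → N ↠h W → Awaiting i q W → EventuallyAwaiting i q M
    ⇛-EventuallyAwaiting⁻ ⇛-refl r aw = _ , r , aw
    ⇛-EventuallyAwaiting⁻ (⇛-reduce r ag) ε aw = _ , r , Agree-Awaiting (Agree-sym ag) aw
    ⇛-EventuallyAwaiting⁻ (⇛-reduce r ag) (s ◅ r′) aw with Agree-⇛ₐ-→hʳ ag s
    ... | _ , s′ , d = ↠h-EventuallyAwaiting (r ◅◅ s′ ◅ ε) (⇛-EventuallyAwaiting⁻ d r′ aw)

    EqClosure-⇛-EventuallyAwaiting : ∀ {M N} → EqClosure _⇛_ M N →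
      EventuallyAwaiting i q M → EventuallyAwaiting i q N
    EqClosure-⇛-EventuallyAwaiting ε ea = ea
    EqClosure-⇛-EventuallyAwaiting (fwd d ◅ c) (_ , r , aw) =
      EqClosure-⇛-EventuallyAwaiting c (⇛-EventuallyAwaiting d r aw)
    EqClosure-⇛-EventuallyAwaiting (bwd d ◅ c) (_ , r , aw) =
      EqClosure-⇛-EventuallyAwaiting c (⇛-EventuallyAwaiting⁻ d r aw)

  EqClosure-on-#⁻¹ : ∀ {_∼_ : Machine A → Machine A → Set} {a b} →
    EqClosure _∼_ (#⁻¹ a) (#⁻¹ b) → EqClosure (λ x y → #⁻¹ x ∼ #⁻¹ y) a b
  EqClosure-on-#⁻¹ {_∼_} {a} {b} c = subst₂ (EqClosure _) (#∘#⁻¹ a) (#∘#⁻¹ b)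
    (EqClosure.gmap # (subst₂ _∼_ (sym (#⁻¹∘# _)) (sym (#⁻¹∘# _))) c)

  mutual
    ≡𝔸⇒EqClosure-⇛ : ∀ {M N} → M ≡𝔸 N → EqClosure _⇛_ M N
    ≡𝔸⇒EqClosure-⇛ (eval r z)   = fwd (⇛-reduce r (Agree-refl ⇛-refl)) ◅ =𝔸⇒EqClosure-⇛ z
    ≡𝔸⇒EqClosure-⇛ refl𝔸        = ε
    ≡𝔸⇒EqClosure-⇛ (sym𝔸 d)     = EqClosure.symmetric _ (≡𝔸⇒EqClosure-⇛ d)
    ≡𝔸⇒EqClosure-⇛ (trans𝔸 d e) = ≡𝔸⇒EqClosure-⇛ d ◅◅ ≡𝔸⇒EqClosure-⇛ e

    =𝔸⇒EqClosure-⇛ : ∀ {M N} → M =𝔸 N → EqClosure _⇛_ M N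
    =𝔸⇒EqClosure-⇛ {mach _ _ _} {mach _ _ _} (mk rs refl ts) with VecPW.length-equal rs
    ... | refl = EqClosure.map (⇛-reduce ε) (Agree-EqClosure ⇛-refl
      (agree (registers-≃𝔸⇒EqClosure-⇛ₐ rs) (cells-≃𝔸⇒EqClosure-⇛ₐ ts)))

    ≃𝔸⇒EqClosure-⇛ₐ : ∀ {a b} → a ≃𝔸 b → EqClosure _⇛ₐ_ a b
    ≃𝔸⇒EqClosure-⇛ₐ d = EqClosure-on-#⁻¹ (≡𝔸⇒EqClosure-⇛ d)

    registers-≃𝔸⇒EqClosure-⇛ₐ : ∀ {r} {R₁ R₂ : Vec (Maybe A) r} →
      Registers _≃𝔸_ R₁ R₂ → Registers (EqClosure _⇛ₐ_) R₁ R₂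
    registers-≃𝔸⇒EqClosure-⇛ₐ []             = []
    registers-≃𝔸⇒EqClosure-⇛ₐ (just d ∷ rs)  = just (≃𝔸⇒EqClosure-⇛ₐ d) ∷ registers-≃𝔸⇒EqClosure-⇛ₐ rs
    registers-≃𝔸⇒EqClosure-⇛ₐ (nothing ∷ rs) = nothing ∷ registers-≃𝔸⇒EqClosure-⇛ₐ rs

    cells-≃𝔸⇒EqClosure-⇛ₐ : ∀ {T₁ T₂} → ListPW.Pointwise _≃𝔸_ T₁ T₂ → ListPW.Pointwise (EqClosure _⇛ₐ_) T₁ T₂
    cells-≃𝔸⇒EqClosure-⇛ₐ []       = []
    cells-≃𝔸⇒EqClosure-⇛ₐ (d ∷ ts) = ≃𝔸⇒EqClosure-⇛ₐ d ∷ cells-≃𝔸⇒EqClosure-⇛ₐ ts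

  ≡𝔸-Awaiting-program : ∀ {M N i j q q′} → M ≡𝔸 N → Awaiting i q M → Awaiting j q′ N → Load i q ≡ Load j q′
  ≡𝔸-Awaiting-program d awM awN with EqClosure-⇛-EventuallyAwaiting (≡𝔸⇒EqClosure-⇛ d) (_ , ε , awM)
  ... | _ , s ◅ _ , _        = ⊥-elim (Awaiting-stuck awN s)
  ... | _ , ε     , (p , _) = trans (sym p) (proj₁ awN)

  𝖪≄𝖲 : ¬ (# 𝖪 ≃𝔸 # 𝖲)
  𝖪≄𝖲 d with ≡𝔸-Awaiting-program (subst₂ _≡𝔸_ (#⁻¹∘# 𝖪) (#⁻¹∘# 𝖲) d) (refl , refl) (refl , refl)
  ... | ()

  isCombinatoryAlgebra : IsCombinatoryAlgebra _≃𝔸_ _·_ (# 𝖪) (# 𝖲)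
  isCombinatoryAlgebra = record
    { isEquivalence = record { refl = refl𝔸 ; sym = sym𝔸 ; trans = trans𝔸 }
    ; ∙-cong        = ·-cong
    ; k≠s           = 𝖪≄𝖲
    ; k-law         = k-law
    ; s-law         = s-law
    }

  𝖨 𝖨′ : Machine A
  𝖨  = mach (nothing ∷ []) (Load 0 ⌜ Call 0 ⌝) []
  -- The product computed by App lands in register 1, which does not exist, so it is discarded.
  𝖨′ = mach (nothing ∷ []) (Load 0 ⌜ App 0 0 1 (Call 0) ⌝) []

  ¬extensional : ¬ Extensional _≃𝔸_ _·_
  ¬extensional ext with ≡𝔸-Awaiting-program (subst₂ _≡𝔸_ (#⁻¹∘# 𝖨) (#⁻¹∘# 𝖨′) 𝖨≃𝖨′) (refl , refl) (refl , refl)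
    where
    𝖨≃𝖨′ : # 𝖨 ≃𝔸 # 𝖨′
    𝖨≃𝖨′ = ext (# 𝖨) (# 𝖨′) λ z →
      trans𝔸 (foldl-·-≃𝔸 𝖨 [ z ] (load ◅ call-[] refl ◅ ε))
             (sym𝔸 (foldl-·-≃𝔸 𝖨′ [ z ] (load ◅ app refl refl ◅ call-[] refl ◅ ε)))
  ... | ()

proposition3p12 : (A : Set) → (countable : A ↣ ℕ) → (enc : Machine A ↔ A) →
    IsCombinatoryAlgebra (Addressing._≃𝔸_ enc) (Addressing._·_ enc) (Addressing.# enc 𝖪) (Addressing.# enc 𝖲)
    × ¬ Extensional (Addressing._≃𝔸_ enc) (Addressing._·_ enc)
proposition3p12 A _ enc = isCombinatoryAlgebra , ¬extensional
  where open Properties enc
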